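{- Let $T=(V,E)$ be a maximal outerplanar graph in the family $\mathcal{F}$ and let $u$ be a vertex of degree 2 in $T$. Then $T$ has a set $D=\{v,w\}$ of cardinality 2 such that every vertex of $V\setminus\{u\}$ is in $D$ or adjacent to a vertex of $D$, and $d_T(v,w)\le 2$, $d_T(u,v)=2$, $d_T(u,w)=2$.
   Context: A maximal outerplanar graph (MOP) is a biconnected planar graph with a plane embedding in which all vertices lie on the boundary cycle of the outer face and all bounded faces are triangles. The family $\mathcal{F}$ consists of the MOPs of order 9 obtained from a MOP of order 6 by adding, for each of three alternating edges on the boundary cycle of its outer face, a new vertex adjacent exactly to the two endpoints of that edge. $d_T(x,y)$ denotes the distance between vertices $x,y$ in $T$. -}

module Defs where

open import Data.Nat using (ℕ; zero; suc; _+_; _*_; _<_; _≤_; _%_; _∸_; _≡ᵇ_; _<ᵇ_)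
open import Data.Bool using (Bool; true; false; _∧_; _∨_; not; if_then_else_)
open import Data.Fin using (Fin; toℕ)
open import Data.List using (List; length; filterᵇ; allFin)
open import Data.Product using (Σ; _×_; _,_; ∃)
open import Data.Sum using (_⊎_)
open import Relation.Nullary using (¬_)
open import Relation.Binary.PropositionalEquality using (_≡_; _≢_)
open import Function.Bundles using (_↔_; Inverse)

Graph9 : Set
Graph9 = Fin 9 → Fin 9 → Bool

Adj : Graph9 → Fin 9 → Fin 9 → Set
Adj G x y = G x y ≡ true

degree : Graph9 → Fin 9 → ℕ
degree G x = length (filterᵇ (G x) (allFin 9))

data Walk (G : Graph9) : ℕ → Fin 9 → Fin 9 → Set where
  here : ∀ {x} → Walk G zero x x
  step : ∀ {n x y z} → Adj G x y → Walk G n y z → Walk G (suc n) x z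

Dist : Graph9 → Fin 9 → Fin 9 → ℕ → Set
Dist G x y n = Walk G n x y × (∀ m → m < n → ¬ Walk G m x y)

-- MOPs of order 6: the hexagon with boundary cycle 0-1-2-3-4-5-0
-- triangulated by 3 pairwise distinct, pairwise non-crossing diagonals
-- (a maximal set of non-crossing diagonals of a hexagon has exactly 3).

Diag : Set
Diag = Fin 6 × Fin 6

-- a diagonal (a,b), written with a < b, joining non-consecutive vertices
ValidDiag : Diag → Set
ValidDiag (a , b) = (toℕ a + 2 ≤ toℕ b) × ¬ (toℕ a ≡ 0 × toℕ b ≡ 5)

Crossing : Diag → Diag → Set
Crossing (a , b) (c , d) =
  (toℕ a < toℕ c × toℕ c < toℕ b × toℕ b < toℕ d) ⊎
  (toℕ c < toℕ a × toℕ a < toℕ d × toℕ d < toℕ b)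

record Triangulation6 : Set where
  field
    d₁ d₂ d₃ : Diag
    valid₁ : ValidDiag d₁
    valid₂ : ValidDiag d₂
    valid₃ : ValidDiag d₃
    dist₁₂ : d₁ ≢ d₂
    dist₁₃ : d₁ ≢ d₃
    dist₂₃ : d₂ ≢ d₃
    nc₁₂ : ¬ Crossing d₁ d₂
    nc₁₃ : ¬ Crossing d₁ d₃
    nc₂₃ : ¬ Crossing d₂ d₃

diagEdge : Diag → ℕ → ℕ → Bool
diagEdge (a , b) i j =
  ((toℕ a ≡ᵇ i) ∧ (toℕ b ≡ᵇ j)) ∨ ((toℕ a ≡ᵇ j) ∧ (toℕ b ≡ᵇ i))

cycEdge : ℕ → ℕ → Bool
cycEdge i j = (suc i ≡ᵇ j) ∨ (suc j ≡ᵇ i)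
  ∨ ((i ≡ᵇ 0) ∧ (j ≡ᵇ 5)) ∨ ((i ≡ᵇ 5) ∧ (j ≡ᵇ 0))

hexAdj : Triangulation6 → ℕ → ℕ → Bool
hexAdj t i j = cycEdge i j ∨ diagEdge (Triangulation6.d₁ t) i j
  ∨ diagEdge (Triangulation6.d₂ t) i j ∨ diagEdge (Triangulation6.d₃ t) i j

-- ear vertex 6+k (k = 0,1,2) is adjacent exactly to the endpoints of the
-- boundary edge {s+2k, s+2k+1} (mod 6); s ∈ {0,1} selects which of the two
-- alternating triples of boundary edges is used.
earAdj : ℕ → ℕ → ℕ → Bool
earAdj s k h = (h ≡ᵇ ((s + 2 * k) % 6)) ∨ (h ≡ᵇ ((s + 2 * k + 1) % 6))

canonN : Triangulation6 → ℕ → ℕ → ℕ → Bool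
canonN t s i j =
  if (i <ᵇ 6) then (if (j <ᵇ 6) then hexAdj t i j else earAdj s (j ∸ 6) i)
  else (if (j <ᵇ 6) then earAdj s (i ∸ 6) j else false)

canon : Triangulation6 → Fin 2 → Graph9
canon t s x y = canonN t (toℕ s) (toℕ x) (toℕ y)

InF : Graph9 → Set
InF G = Σ Triangulation6 λ t → Σ (Fin 2) λ s → Σ (Fin 9 ↔ Fin 9) λ σ →
  ∀ x y → G x y ≡ canon t s (Inverse.to σ x) (Inverse.to σ y)

-- Up to isomorphism T is a canonical member of F: a triangulated hexagon 0 … 5 with
-- ears 6, 7, 8 on alternate boundary edges. Every hexagon vertex has its two boundary
-- neighbours and an ear as neighbours, so the vertices of degree 2 are exactly the ears.
-- A hexagon has finitely many triangulations, and for each of them and each ear an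
-- exhaustive search finds the pair {v, w}; everything is transported back along the
-- isomorphism.
module Submission where

open import Defs
open import Data.Bool using (Bool; true; false; _∨_; if_then_else_)
import Data.Bool.Properties as Bool
open import Data.Fin using (Fin; suc; toℕ; _↑ʳ_)
open import Data.Fin.Patterns using (0F; 1F; 2F; 3F; 4F; 5F; 6F; 7F; 8F)
open import Data.Fin.Properties using (_≟_; all?; any?; injective⇒≤)
open import Data.List using (List; length; lookup; allFin; filter; cartesianProduct)
open import Data.List.Membership.Propositional using (_∈_)
open import Data.List.Membership.Propositional.Properties
  using (∈-allFin; ∈-filter⁺; ∈-cartesianProduct⁺)
open import Data.List.Relation.Unary.All as All using (All)
open import Data.List.Relation.Unary.Any using (index)
open import Data.List.Relation.Unary.Any.Properties using (lookup-index)
open import Data.Nat using (ℕ; suc; _+_; _≤_; _<_; _<ᵇ_; _∸_; z≤n; s≤s)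
import Data.Nat.Properties as ℕ
open import Data.Product using (Σ; ∃; ∃₂; _×_; _,_)
open import Data.Product.Properties using (≡-dec)
open import Data.Sum using (_⊎_; inj₁; inj₂; [_,_]′)
import Data.Sum as Sum
open import Data.Vec using (_∷_; [])
import Data.Vec as Vec
open import Function using (_∘_)
open import Function.Bundles using (_↔_; Inverse; Equivalence)
open import Function.Definitions using (Injective)
open import Relation.Nullary using (¬_; Dec; yes; no; ¬?; contradiction)
open import Relation.Nullary.Decidable
  using (False; toWitnessFalse; from-yes; _×-dec_; _⊎-dec_; _→-dec_; T?)
open import Relation.Binary.PropositionalEquality
  using (_≡_; _≢_; refl; sym; trans; cong; subst; subst₂)

CommonNeighbour : Graph9 → Fin 9 → Fin 9 → Set
CommonNeighbour G a b = ∃ λ c → Adj G a c × Adj G c b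

TwoApart : Graph9 → Fin 9 → Fin 9 → Set
TwoApart G a b = a ≢ b × ¬ Adj G a b × CommonNeighbour G a b

DominatesAllBut : Graph9 → Fin 9 → Fin 9 → Fin 9 → Set
DominatesAllBut G u v w = ∀ x → x ≢ u → x ≡ v ⊎ x ≡ w ⊎ Adj G v x ⊎ Adj G w x

DominatingPair : Graph9 → Fin 9 → Fin 9 → Fin 9 → Set
DominatingPair G u v w =
  v ≢ w
  × DominatesAllBut G u v w
  × (Σ ℕ λ m → m ≤ 2 × Dist G v w m)
  × Dist G u v 2
  × Dist G u w 2

-- The distance conditions of a DominatingPair replaced by decidable local ones.
DominatingPairCertificate : Graph9 → Fin 9 → Fin 9 → Fin 9 → Set
DominatingPairCertificate G u v w =
  v ≢ w
  × DominatesAllBut G u v w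
  × (Adj G v w ⊎ CommonNeighbour G v w)
  × TwoApart G u v
  × TwoApart G u w

record DistinctNeighbours (G : Graph9) (h : Fin 9) (k : ℕ) : Set where
  field
    neighbour : Fin k → Fin 9
    neighbour-injective : Injective _≡_ _≡_ neighbour
    adjacent : ∀ i → Adj G h (neighbour i)

module _ {G : Graph9} where

  walk₀⇒≡ : ∀ {a b} → Walk G 0 a b → a ≡ b
  walk₀⇒≡ here = refl

  walk₁⇒adj : ∀ {a b} → Walk G 1 a b → Adj G a b
  walk₁⇒adj (step a~b here) = a~b

  commonNeighbour⇒walk₂ : ∀ {a b} → CommonNeighbour G a b → Walk G 2 a b
  commonNeighbour⇒walk₂ (c , a~c , c~b) = step a~c (step c~b here)

  adj⇒dist₁ : ∀ {a b} → a ≢ b → Adj G a b → Dist G a b 1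
  adj⇒dist₁ {a} {b} a≢b a~b = step a~b here , shorter
    where
      shorter : ∀ m → m < 1 → ¬ Walk G m a b
      shorter 0 _ walk = a≢b (walk₀⇒≡ walk)
      shorter (suc _) (s≤s ())

  twoApart⇒dist₂ : ∀ {a b} → TwoApart G a b → Dist G a b 2
  twoApart⇒dist₂ {a} {b} (a≢b , a≁b , common) = commonNeighbour⇒walk₂ common , shorter
    where
      shorter : ∀ m → m < 2 → ¬ Walk G m a b
      shorter 0 _ walk = a≢b (walk₀⇒≡ walk)
      shorter 1 _ walk = a≁b (walk₁⇒adj walk)
      shorter (suc (suc _)) (s≤s (s≤s ()))

  adj? : ∀ a b → Dec (Adj G a b)
  adj? a b = G a b Bool.≟ true

  dist≤₂ : ∀ {a b} → a ≢ b → Adj G a b ⊎ CommonNeighbour G a b →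
           Σ ℕ λ m → m ≤ 2 × Dist G a b m
  dist≤₂ {a} {b} a≢b near with adj? a b
  ... | yes a~b = 1 , s≤s z≤n , adj⇒dist₁ a≢b a~b
  ... | no a≁b  = 2 , ℕ.≤-refl ,
    twoApart⇒dist₂ (a≢b , a≁b , Sum.fromInj₂ (λ a~b → contradiction a~b a≁b) near)

  certificate⇒dominatingPair : ∀ {u v w} →
    DominatingPairCertificate G u v w → DominatingPair G u v w
  certificate⇒dominatingPair (v≢w , dom , near , u-v , u-w) =
    v≢w , dom , dist≤₂ v≢w near , twoApart⇒dist₂ u-v , twoApart⇒dist₂ u-w

  commonNeighbour? : ∀ a b → Dec (CommonNeighbour G a b)
  commonNeighbour? a b = any? λ c → adj? a c ×-dec adj? c b

  twoApart? : ∀ a b → Dec (TwoApart G a b)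
  twoApart? a b = ¬? (a ≟ b) ×-dec ¬? (adj? a b) ×-dec commonNeighbour? a b

  dominatesAllBut? : ∀ u v w → Dec (DominatesAllBut G u v w)
  dominatesAllBut? u v w = all? λ x →
    ¬? (x ≟ u) →-dec (x ≟ v ⊎-dec x ≟ w ⊎-dec adj? v x ⊎-dec adj? w x)

  certificate? : ∀ u v w → Dec (DominatingPairCertificate G u v w)
  certificate? u v w =
    ¬? (v ≟ w) ×-dec dominatesAllBut? u v w ×-dec (adj? v w ⊎-dec commonNeighbour? v w)
    ×-dec twoApart? u v ×-dec twoApart? u w

injective-members⇒≤length : ∀ {A : Set} {k} {xs : List A} {f : Fin k → A} →
  Injective _≡_ _≡_ f → (∀ i → f i ∈ xs) → k ≤ length xs
injective-members⇒≤length {xs = xs} {f} f-injective f∈xs = injective⇒≤ index-injective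
  where
    index-injective : Injective _≡_ _≡_ (index ∘ f∈xs)
    index-injective {i} {j} eq = f-injective
      (trans (lookup-index (f∈xs i)) (trans (cong (lookup xs) eq) (sym (lookup-index (f∈xs j)))))

distinctNeighbours⇒≤degree : ∀ {G h k} → DistinctNeighbours G h k → k ≤ degree G h
distinctNeighbours⇒≤degree {G} {h} neighbours =
  injective-members⇒≤length neighbour-injective λ i →
    ∈-filter⁺ (T? ∘ G h) (∈-allFin (neighbour i)) (Equivalence.from Bool.T-≡ (adjacent i))
  where open DistinctNeighbours neighbours

module Isomorphism {G H : Graph9} (σ : Fin 9 ↔ Fin 9)
                   (G≅H : ∀ x y → G x y ≡ H (Inverse.to σ x) (Inverse.to σ y)) where
  open Inverse σ using (to; from; strictlyInverseˡ; strictlyInverseʳ)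

  to-injective : ∀ {x y} → to x ≡ to y → x ≡ y
  to-injective {x} {y} eq =
    trans (sym (strictlyInverseʳ x)) (trans (cong from eq) (strictlyInverseʳ y))

  from-injective : ∀ {a b} → from a ≡ from b → a ≡ b
  from-injective {a} {b} eq =
    trans (sym (strictlyInverseˡ a)) (trans (cong to eq) (strictlyInverseˡ b))

  to≡⇒≡from : ∀ {x a} → to x ≡ a → x ≡ from a
  to≡⇒≡from {x} eq = trans (sym (strictlyInverseʳ x)) (cong from eq)

  adj-to : ∀ {x y} → Adj G x y → Adj H (to x) (to y)
  adj-to {x} {y} x~y = trans (sym (G≅H x y)) x~y

  adj-from : ∀ {a b} → Adj H a b → Adj G (from a) (from b)
  adj-from {a} {b} a~b rewrite G≅H (from a) (from b) | strictlyInverseˡ a | strictlyInverseˡ b = a~b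

  adj-from-to : ∀ {a x} → Adj H a (to x) → Adj G (from a) x
  adj-from-to {a} {x} a~x rewrite G≅H (from a) x | strictlyInverseˡ a = a~x

  walk-to : ∀ {n x y} → Walk G n x y → Walk H n (to x) (to y)
  walk-to here = here
  walk-to (step x~z walk) = step (adj-to x~z) (walk-to walk)

  walk-from : ∀ {n a b} → Walk H n a b → Walk G n (from a) (from b)
  walk-from here = here
  walk-from (step a~c walk) = step (adj-from a~c) (walk-from walk)

  dist-from : ∀ {n a b} → Dist H a b n → Dist G (from a) (from b) n
  dist-from {a = a} {b} (walk , shortest) = walk-from walk , λ m m<n walk′ →
    shortest m m<n (subst₂ (Walk H m) (strictlyInverseˡ a) (strictlyInverseˡ b) (walk-to walk′))

  dist-from-to : ∀ {n x b} → Dist H (to x) b n → Dist G x (from b) n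
  dist-from-to {n} {x} {b} d = subst (λ y → Dist G y (from b) n) (strictlyInverseʳ x) (dist-from d)

  dominatingPair-transfer : ∀ u → ∃₂ (DominatingPair H (to u)) → ∃₂ (DominatingPair G u)
  dominatingPair-transfer u (v , w , v≢w , dom , (m , m≤2 , v-w) , u-v , u-w) =
    from v , from w , v≢w ∘ from-injective , dom′ , (m , m≤2 , dist-from v-w) ,
    dist-from-to u-v , dist-from-to u-w
    where
      dom′ : DominatesAllBut G u (from v) (from w)
      dom′ x x≢u = Sum.map to≡⇒≡from (Sum.map to≡⇒≡from (Sum.map adj-from-to adj-from-to))
                     (dom (to x) (x≢u ∘ to-injective))

  distinctNeighbours-transfer : ∀ {k} u → DistinctNeighbours H (to u) k → DistinctNeighbours G u k
  distinctNeighbours-transfer u neighbours = record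
    { neighbour = from ∘ neighbour
    ; neighbour-injective = neighbour-injective ∘ from-injective
    ; adjacent = λ i → subst (λ y → Adj G y _) (strictlyInverseʳ u) (adj-from (adjacent i))
    }
    where open DistinctNeighbours neighbours

Diagonals : Set
Diagonals = Diag × Diag × Diag

diagonals : Triangulation6 → Diagonals
diagonals t = d₁ , d₂ , d₃
  where open Triangulation6 t

IsTriangulation : Diagonals → Set
IsTriangulation (d₁ , d₂ , d₃) =
  ValidDiag d₁ × ValidDiag d₂ × ValidDiag d₃
  × d₁ ≢ d₂ × d₁ ≢ d₃ × d₂ ≢ d₃
  × ¬ Crossing d₁ d₂ × ¬ Crossing d₁ d₃ × ¬ Crossing d₂ d₃

triangulation-isTriangulation : ∀ t → IsTriangulation (diagonals t)
triangulation-isTriangulation t =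
  valid₁ , valid₂ , valid₃ , dist₁₂ , dist₁₃ , dist₂₃ , nc₁₂ , nc₁₃ , nc₂₃
  where open Triangulation6 t

validDiag? : ∀ d → Dec (ValidDiag d)
validDiag? (a , b) = toℕ a + 2 ℕ.≤? toℕ b ×-dec ¬? (toℕ a ℕ.≟ 0 ×-dec toℕ b ℕ.≟ 5)

crossing? : ∀ d e → Dec (Crossing d e)
crossing? (a , b) (c , d) =
  (toℕ a ℕ.<? toℕ c ×-dec toℕ c ℕ.<? toℕ b ×-dec toℕ b ℕ.<? toℕ d) ⊎-dec
  (toℕ c ℕ.<? toℕ a ×-dec toℕ a ℕ.<? toℕ d ×-dec toℕ d ℕ.<? toℕ b)

isTriangulation? : ∀ ds → Dec (IsTriangulation ds)
isTriangulation? (d₁ , d₂ , d₃) =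
  validDiag? d₁ ×-dec validDiag? d₂ ×-dec validDiag? d₃
  ×-dec ¬? (d₁ ≟ᴰ d₂) ×-dec ¬? (d₁ ≟ᴰ d₃) ×-dec ¬? (d₂ ≟ᴰ d₃)
  ×-dec ¬? (crossing? d₁ d₂) ×-dec ¬? (crossing? d₁ d₃) ×-dec ¬? (crossing? d₂ d₃)
  where
    _≟ᴰ_ : ∀ (d e : Diag) → Dec (d ≡ e)
    _≟ᴰ_ = ≡-dec _≟_ _≟_

validDiags : List Diag
validDiags = filter validDiag? (cartesianProduct (allFin 6) (allFin 6))

validTriples : List Diagonals
validTriples = cartesianProduct validDiags (cartesianProduct validDiags validDiags)

diagonals∈validTriples : ∀ t → diagonals t ∈ validTriples
diagonals∈validTriples t =
  ∈-cartesianProduct⁺ (∈-validDiags valid₁) (∈-cartesianProduct⁺ (∈-validDiags valid₂) (∈-validDiags valid₃))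
  where
    open Triangulation6 t
    ∈-validDiags : ∀ {d} → ValidDiag d → d ∈ validDiags
    ∈-validDiags {a , b} = ∈-filter⁺ validDiag? (∈-cartesianProduct⁺ (∈-allFin a) (∈-allFin b))

-- canon t s reads t only through its diagonals: canon t s and canonOf (diagonals t) s are
-- definitionally equal, so the search below can range over triples of diagonals.
canonOf : Diagonals → Fin 2 → Graph9
canonOf (d₁ , d₂ , d₃) s x y = adjacency (toℕ s) (toℕ x) (toℕ y)
  where
    hexagon : ℕ → ℕ → Bool
    hexagon i j = cycEdge i j ∨ diagEdge d₁ i j ∨ diagEdge d₂ i j ∨ diagEdge d₃ i j
    adjacency : ℕ → ℕ → ℕ → Bool
    adjacency s i j =
      if (i <ᵇ 6) then (if (j <ᵇ 6) then hexagon i j else earAdj s (j ∸ 6) i)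
      else (if (j <ᵇ 6) then earAdj s (i ∸ 6) j else false)

EarsCertified : Diagonals → Set
EarsCertified ds = ∀ s k → ∃₂ (DominatingPairCertificate (canonOf ds s) (6 ↑ʳ k))

earsCertified? : ∀ ds → Dec (EarsCertified ds)
earsCertified? ds = all? λ s → all? λ k → any? λ v → any? λ w →
  certificate? (6 ↑ʳ k) v w

-- Opaque, so that using the lemma never re-runs the search.
opaque
  every-triangulation-earsCertified : All (λ ds → IsTriangulation ds → EarsCertified ds) validTriples
  every-triangulation-earsCertified =
    from-yes (All.all? (λ ds → isTriangulation? ds →-dec earsCertified? ds) validTriples)

IsEar : Fin 9 → Set
IsEar h = ∃ λ k → h ≡ 6 ↑ʳ k

ear-dominatingPair : ∀ t s {h} → IsEar h → ∃₂ (DominatingPair (canon t s) h)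
ear-dominatingPair t s (k , refl) =
  let v , w , certificate = All.lookup every-triangulation-earsCertified (diagonals∈validTriples t)
                              (triangulation-isTriangulation t) s k
  in v , w , certificate⇒dominatingPair certificate

distinctNeighbours₃ : ∀ {G h} a b c {_ : False (a ≟ b)} {_ : False (a ≟ c)} {_ : False (b ≟ c)} →
  Adj G h a → Adj G h b → Adj G h c → DistinctNeighbours G h 3
distinctNeighbours₃ {G} {h} a b c {a≟b} {a≟c} {b≟c} h~a h~b h~c = record
  { neighbour = Vec.lookup (a ∷ b ∷ c ∷ [])
  ; neighbour-injective = injective
  ; adjacent = adjacent
  }
  where
    injective : Injective _≡_ _≡_ (Vec.lookup (a ∷ b ∷ c ∷ []))
    injective {0F} {0F} _ = refl
    injective {0F} {1F} a≡b = contradiction a≡b (toWitnessFalse a≟b)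
    injective {0F} {2F} a≡c = contradiction a≡c (toWitnessFalse a≟c)
    injective {1F} {0F} b≡a = contradiction (sym b≡a) (toWitnessFalse a≟b)
    injective {1F} {1F} _ = refl
    injective {1F} {2F} b≡c = contradiction b≡c (toWitnessFalse b≟c)
    injective {2F} {0F} c≡a = contradiction (sym c≡a) (toWitnessFalse a≟c)
    injective {2F} {1F} c≡b = contradiction (sym c≡b) (toWitnessFalse b≟c)
    injective {2F} {2F} _ = refl
    adjacent : ∀ i → Adj G h (Vec.lookup (a ∷ b ∷ c ∷ []) i)
    adjacent 0F = h~a
    adjacent 1F = h~b
    adjacent 2F = h~c

ear-or-distinctNeighbours₃ : ∀ t s h → IsEar h ⊎ DistinctNeighbours (canon t s) h 3
ear-or-distinctNeighbours₃ t 0F 0F = inj₂ (distinctNeighbours₃ 1F 5F 6F refl refl refl)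
ear-or-distinctNeighbours₃ t 0F 1F = inj₂ (distinctNeighbours₃ 0F 2F 6F refl refl refl)
ear-or-distinctNeighbours₃ t 0F 2F = inj₂ (distinctNeighbours₃ 1F 3F 7F refl refl refl)
ear-or-distinctNeighbours₃ t 0F 3F = inj₂ (distinctNeighbours₃ 2F 4F 7F refl refl refl)
ear-or-distinctNeighbours₃ t 0F 4F = inj₂ (distinctNeighbours₃ 3F 5F 8F refl refl refl)
ear-or-distinctNeighbours₃ t 0F 5F = inj₂ (distinctNeighbours₃ 4F 0F 8F refl refl refl)
ear-or-distinctNeighbours₃ t 1F 0F = inj₂ (distinctNeighbours₃ 1F 5F 8F refl refl refl)
ear-or-distinctNeighbours₃ t 1F 1F = inj₂ (distinctNeighbours₃ 0F 2F 6F refl refl refl)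
ear-or-distinctNeighbours₃ t 1F 2F = inj₂ (distinctNeighbours₃ 1F 3F 6F refl refl refl)
ear-or-distinctNeighbours₃ t 1F 3F = inj₂ (distinctNeighbours₃ 2F 4F 7F refl refl refl)
ear-or-distinctNeighbours₃ t 1F 4F = inj₂ (distinctNeighbours₃ 3F 5F 7F refl refl refl)
ear-or-distinctNeighbours₃ t 1F 5F = inj₂ (distinctNeighbours₃ 4F 0F 8F refl refl refl)
ear-or-distinctNeighbours₃ t s (suc (suc (suc (suc (suc (suc k)))))) = inj₁ (k , refl)

lemma8 : (G : Graph9) → InF G → (u : Fin 9) → degree G u ≡ 2 →
    Σ (Fin 9) λ v → Σ (Fin 9) λ w →
      v ≢ w
      × (∀ x → x ≢ u → x ≡ v ⊎ x ≡ w ⊎ Adj G v x ⊎ Adj G w x)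
      × (Σ ℕ λ m → m ≤ 2 × Dist G v w m)
      × Dist G u v 2
      × Dist G u w 2
lemma8 G (t , s , σ , G≅canon) u degree≡2 =
  [ dominatingPair-transfer u ∘ ear-dominatingPair t s
  , (λ neighbours → contradiction (distinctNeighbours⇒≤degree (distinctNeighbours-transfer u neighbours))
                                  (ℕ.<-irrefl (sym degree≡2)))
  ]′ (ear-or-distinctNeighbours₃ t s (Inverse.to σ u))
  where open Isomorphism {H = canon t s} σ G≅canon
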